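{- Let $c\ge2$ be a constant integer, $n=\frac{c^l-1}{c-1}$, and $k<n/2$. There exists a constant $c'$ such that, with $K=c'k\log(n/k)$, every $k$-sparse vector in $\mathbb{R}^n$ lies in $\mathcal{T}_K$, i.e., $\Sigma_k\subseteq\mathcal{T}_K$.
   Context: Coordinates $1,\dots,n$ are identified with the nodes of a full $c$-ary rooted tree $T(c,l)$ of depth $l$. $\Sigma_k$ is the set of vectors with at most $k$ nonzero coordinates. $\mathcal{T}_K$ is the set of vectors whose support is contained in some set of at most $K$ nodes that contains the root and is connected in $T(c,l)$. -}

module Defs where

open import Data.Nat using (ℕ; zero; suc; _+_; _*_; _^_; _≤_; _<_)
open import Data.Fin using (Fin)
open import Data.List using (List; []; _∷_; length)
open import Data.List.Membership.Propositional using (_∈_)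
open import Data.Product using (Σ; ∃; ∃-syntax; _×_; _,_; proj₁)
open import Data.Sum using (_⊎_)
open import Relation.Binary.PropositionalEquality using (_≡_)
open import Relation.Nullary using (¬_)

-- Number of nodes of the full c-ary tree of depth l (levels 0 .. l-1):
-- n = 1 + c + ... + c^(l-1) = (c^l - 1)/(c - 1).
treeSize : ℕ → ℕ → ℕ
treeSize c zero    = 0
treeSize c (suc l) = 1 + c * treeSize c l

-- Nodes of the infinite c-ary tree are words over Fin c (the path from the
-- root, most recent step first).  The root is the empty word, the children
-- of w are i ∷ w.
Word : ℕ → Set
Word c = List (Fin c)

root : ∀ {c} → Word c
root = []

IsNode : ∀ {c} → ℕ → Word c → Set
IsNode l w = length w < l

TNode : ℕ → ℕ → Set
TNode c l = Σ (Word c) (IsNode l)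

Adj : ∀ {c} → Word c → Word c → Set
Adj {c} u v = (∃[ i ] v ≡ i ∷ u) ⊎ (∃[ i ] u ≡ i ∷ v)

data Reach {c} (S : List (Word c)) (u : Word c) : Word c → Set where
  here : u ∈ S → Reach S u u
  step : ∀ {w v} → Reach S u w → Adj w v → v ∈ S → Reach S u v

Connected : ∀ {c} → List (Word c) → Set
Connected S = ∀ {u v} → u ∈ S → v ∈ S → Reach S u v

SuppIn : ∀ {c l} (A : Set) (0# : A) → (TNode c l → A) → List (Word c) → Set
SuppIn A 0# x S = ∀ p → ¬ (x p ≡ 0#) → proj₁ p ∈ S

Sparse : ∀ {c l} (A : Set) (0# : A) → ℕ → (TNode c l → A) → Set
Sparse {c} {l} A 0# k x =
  ∃[ S ] (length S ≤ k × (∀ {w} → w ∈ S → IsNode l w) × SuppIn A 0# x S)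

InTK : ∀ {c l} (A : Set) (0# : A) → ℕ → (TNode c l → A) → Set
InTK {c} {l} A 0# K x =
  ∃[ S ] (length S ≤ K × (∀ {w} → w ∈ S → IsNode l w)
          × root ∈ S × Connected S × SuppIn A 0# x S)

-- K ≤ c' k log₂(n/k)  ⇔  k^(c' k) · 2^K ≤ n^(c' k)   (exact, no reals).
Budget : (c' k n K : ℕ) → Set
Budget c' k n K = k ^ (c' * k) * 2 ^ K ≤ n ^ (c' * k)

-- Let D = ⌊log_c k⌋.  The support S of x, together with every node of depth
-- at most D and every ancestor of a support node, is a rooted connected set.
-- The top D+1 levels contribute fewer than 2 c^D ≤ 2k nodes, and each of the
-- k support nodes adds at most j = l - 1 - D ancestors below depth D, so
-- K ≤ (2 + j) k.  Since k c^j ≤ c n, we get 2^j k ≤ 2n, hence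
-- 2^(2+j) k^4 ≤ n^4, which is K ≤ 4 k log₂(n/k) in exponentiated form.
module Submission where

open import Defs
open import Data.Nat using (ℕ; zero; suc; _+_; _*_; _∸_; _^_; _≤_; _<_; z≤n; s≤s; _≤?_; _<?_; >-nonZero)
open import Data.Nat.Properties
open import Data.Nat.Tactic.RingSolver using (solve-∀)
open import Algebra.Properties.CommutativeSemigroup *-commutativeSemigroup using (x∙yz≈y∙xz)
open import Data.List using (List; []; _∷_; length; map; _++_; concatMap; allFin)
open import Data.List.Properties using (length-++; length-map; length-tabulate)
open import Data.List.Membership.Propositional using (_∈_; find; lose)
open import Data.List.Membership.Propositional.Properties using (∈-++⁺ˡ; ∈-++⁺ʳ; ∈-++⁻; ∈-map⁺; ∈-map⁻; ∈-allFin; ∈-concatMap⁺; ∈-concatMap⁻)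
open import Data.List.Relation.Unary.Any using (here; there)
open import Data.List.Relation.Binary.Subset.Propositional using (_⊆_)
open import Data.Product using (∃-syntax; _×_; _,_)
open import Data.Sum using (_⊎_; inj₁; inj₂)
open import Relation.Binary.PropositionalEquality using (_≡_; refl; sym; trans; cong; cong₂; module ≡-Reasoning)
open import Relation.Nullary using (yes; no; contradiction)

private
  variable
    c : ℕ

Adj-sym : ∀ {u v : Word c} → Adj u v → Adj v u
Adj-sym (inj₁ e) = inj₂ e
Adj-sym (inj₂ e) = inj₁ e

module _ {S : List (Word c)} where

  Reach-target∈ : ∀ {u v} → Reach S u v → v ∈ S
  Reach-target∈ (here v∈S)     = v∈S
  Reach-target∈ (step _ _ v∈S) = v∈S

  Reach-trans : ∀ {u v w} → Reach S u v → Reach S v w → Reach S u w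
  Reach-trans r (here _)         = r
  Reach-trans r (step r′ vw w∈S) = step (Reach-trans r r′) vw w∈S

  Reach-sym : ∀ {u v} → Reach S u v → Reach S v u
  Reach-sym (here u∈S)       = here u∈S
  Reach-sym (step r wv v∈S) =
    Reach-trans (step (here v∈S) (Adj-sym wv) (Reach-target∈ r)) (Reach-sym r)

ParentClosed : List (Word c) → Set
ParentClosed S = ∀ {i w} → (i ∷ w) ∈ S → w ∈ S

module _ {S : List (Word c)} (closed : ParentClosed S) where

  parentClosed⇒Reach-root : ∀ w → w ∈ S → Reach S root w
  parentClosed⇒Reach-root []      []∈S  = here []∈S
  parentClosed⇒Reach-root (i ∷ w) iw∈S =
    step (parentClosed⇒Reach-root w (closed iw∈S)) (inj₁ (i , refl)) iw∈S

  parentClosed⇒connected : Connected S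
  parentClosed⇒connected {u} {v} u∈S v∈S =
    Reach-trans (Reach-sym (parentClosed⇒Reach-root u u∈S)) (parentClosed⇒Reach-root v v∈S)

length-concatMap≤ : ∀ {A B : Set} (f : A → List B) {m} xs →
  (∀ {x} → x ∈ xs → length (f x) ≤ m) → length (concatMap f xs) ≤ length xs * m
length-concatMap≤ f []       _ = z≤n
length-concatMap≤ f (x ∷ xs) h = ≤-trans (≤-reflexive (length-++ (f x)))
  (+-mono-≤ (h (here refl)) (length-concatMap≤ f xs (λ x∈xs → h (there x∈xs))))

children : Word c → List (Word c)
children {c} w = map (_∷ w) (allFin c)

length-children : (w : Word c) → length (children w) ≡ c
length-children {c} w = trans (length-map (_∷ w) (allFin c)) (length-tabulate (λ i → i))

ball : ℕ → List (Word c)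
ball zero    = root ∷ []
ball (suc d) = root ∷ concatMap children (ball d)

∈-ball⁺ : ∀ d (w : Word c) → length w ≤ d → w ∈ ball d
∈-ball⁺ zero    []      _         = here refl
∈-ball⁺ (suc d) []      _         = here refl
∈-ball⁺ (suc d) (i ∷ w) (s≤s w≤d) =
  there (∈-concatMap⁺ children (lose (∈-ball⁺ d w w≤d) (∈-map⁺ (_∷ w) (∈-allFin i))))

∈-ball⁻ : ∀ d (w : Word c) → w ∈ ball d → length w ≤ d
∈-ball⁻ d       []      _                 = z≤n
∈-ball⁻ zero    (i ∷ w) (here ())
∈-ball⁻ zero    (i ∷ w) (there ())
∈-ball⁻ (suc d) (i ∷ w) (here ())
∈-ball⁻ (suc d) (i ∷ w) (there iw∈) with find (∈-concatMap⁻ children iw∈)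
... | v , v∈ball , iw∈children with ∈-map⁻ (_∷ v) iw∈children
...   | _ , _ , refl = s≤s (∈-ball⁻ d v v∈ball)

length-ball≤treeSize : ∀ d → length (ball {c} d) ≤ treeSize c (suc d)
length-ball≤treeSize {c = c} zero    = s≤s (≤-reflexive (sym (*-zeroʳ c)))
length-ball≤treeSize {c = c} (suc d) = s≤s (begin
  length (concatMap children (ball d)) ≤⟨ length-concatMap≤ children (ball d) (λ {w} _ → ≤-reflexive (length-children w)) ⟩
  length (ball d) * c                  ≤⟨ *-monoˡ-≤ c (length-ball≤treeSize d) ⟩
  treeSize c (suc d) * c               ≡⟨ *-comm _ c ⟩
  c * treeSize c (suc d)               ∎)
  where open ≤-Reasoning

ancestorsBelow : ℕ → Word c → List (Word c)
ancestorsBelow D []      = []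
ancestorsBelow D (i ∷ w) with D ≤? length w
... | yes _ = (i ∷ w) ∷ ancestorsBelow D w
... | no  _ = []

∈-ancestorsBelow-self : ∀ D (w : Word c) → D < length w → w ∈ ancestorsBelow D w
∈-ancestorsBelow-self D (i ∷ w) (s≤s D≤w) with D ≤? length w
... | yes _   = here refl
... | no D≰w = contradiction D≤w D≰w

ancestorsBelow-parent : ∀ D (w : Word c) {i y} →
  (i ∷ y) ∈ ancestorsBelow D w → D < length y → y ∈ ancestorsBelow D w
ancestorsBelow-parent D (j ∷ w) iy∈ D<y with D ≤? length w
ancestorsBelow-parent D (j ∷ w) (here refl) D<y | yes _ = there (∈-ancestorsBelow-self D w D<y)
ancestorsBelow-parent D (j ∷ w) (there iy∈) D<y | yes _ = there (ancestorsBelow-parent D w iy∈ D<y)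

length-∈ancestorsBelow : ∀ D (w : Word c) {y} → y ∈ ancestorsBelow D w → length y ≤ length w
length-∈ancestorsBelow D (i ∷ w) y∈ with D ≤? length w
length-∈ancestorsBelow D (i ∷ w) (here refl) | yes _ = ≤-refl
length-∈ancestorsBelow D (i ∷ w) (there y∈)  | yes _ = m≤n⇒m≤1+n (length-∈ancestorsBelow D w y∈)

length-ancestorsBelow : ∀ D (w : Word c) → length (ancestorsBelow D w) ≤ length w ∸ D
length-ancestorsBelow D []      = z≤n
length-ancestorsBelow D (i ∷ w) with D ≤? length w
... | yes D≤w = ≤-trans (s≤s (length-ancestorsBelow D w)) (≤-reflexive (sym (+-∸-assoc 1 D≤w)))
... | no  _   = z≤n

hull : ℕ → List (Word c) → List (Word c)
hull D S = ball D ++ concatMap (ancestorsBelow D) S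

module _ (D : ℕ) {S : List (Word c)} where

  ∈-hull-ball : ∀ {w} → length w ≤ D → w ∈ hull D S
  ∈-hull-ball {w} w≤D = ∈-++⁺ˡ (∈-ball⁺ D w w≤D)

  ∈-hull-ancestors : ∀ {w y} → w ∈ S → y ∈ ancestorsBelow D w → y ∈ hull D S
  ∈-hull-ancestors w∈S y∈ = ∈-++⁺ʳ (ball D) (∈-concatMap⁺ (ancestorsBelow D) (lose w∈S y∈))

  ∈-hull⁻ : ∀ {y} → y ∈ hull D S → length y ≤ D ⊎ ∃[ w ] (w ∈ S × y ∈ ancestorsBelow D w)
  ∈-hull⁻ {y} y∈ with ∈-++⁻ (ball D) y∈
  ... | inj₁ y∈ball = inj₁ (∈-ball⁻ D y y∈ball)
  ... | inj₂ y∈anc  = inj₂ (find (∈-concatMap⁻ (ancestorsBelow D) y∈anc))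

  S⊆hull : S ⊆ hull D S
  S⊆hull {w} w∈S with D <? length w
  ... | yes D<w = ∈-hull-ancestors w∈S (∈-ancestorsBelow-self D w D<w)
  ... | no  D≮w = ∈-hull-ball (≮⇒≥ D≮w)

  hull-parentClosed : ParentClosed (hull D S)
  hull-parentClosed {i} {y} iy∈ with D <? length y | ∈-hull⁻ iy∈
  ... | no  D≮y | _                         = ∈-hull-ball (≮⇒≥ D≮y)
  ... | yes D<y | inj₁ y<D                  = contradiction (<-trans D<y y<D) (<-irrefl refl)
  ... | yes D<y | inj₂ (w , w∈S , iy∈anc)   = ∈-hull-ancestors w∈S (ancestorsBelow-parent D w iy∈anc D<y)

  hull-nodes : ∀ {l} → D < l → (∀ {w} → w ∈ S → IsNode l w) → ∀ {y} → y ∈ hull D S → IsNode l y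
  hull-nodes D<l S-nodes y∈ with ∈-hull⁻ y∈
  ... | inj₁ y≤D              = ≤-<-trans y≤D D<l
  ... | inj₂ (w , w∈S , y∈anc) = ≤-<-trans (length-∈ancestorsBelow D w y∈anc) (S-nodes w∈S)

  length-hull≤ : ∀ {m} → (∀ {w} → w ∈ S → length w ≤ m) →
    length (hull D S) ≤ length (ball {c} D) + length S * (m ∸ D)
  length-hull≤ {m} S-depth = ≤-trans (≤-reflexive (length-++ (ball D)))
    (+-monoʳ-≤ (length (ball D)) (length-concatMap≤ (ancestorsBelow D) S
      (λ {w} w∈S → ≤-trans (length-ancestorsBelow D w) (∸-monoˡ-≤ D (S-depth w∈S)))))

treeSize-suc<2*^ : 2 ≤ c → ∀ d → treeSize c (suc d) < 2 * c ^ d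
treeSize-suc<2*^ {c} 2≤c zero    = ≤-reflexive (cong (λ t → 2 + t) (*-zeroʳ c))
treeSize-suc<2*^ {c} 2≤c (suc d) = begin-strict
  1 + c * t       <⟨ +-monoˡ-< (c * t) 2≤c ⟩
  c + c * t       ≡⟨ *-suc c t ⟨
  c * (1 + t)     ≤⟨ *-monoʳ-≤ c (treeSize-suc<2*^ 2≤c d) ⟩
  c * (2 * c ^ d) ≡⟨ x∙yz≈y∙xz c 2 (c ^ d) ⟩
  2 * (c * c ^ d) ∎
  where
  open ≤-Reasoning
  t = treeSize c (suc d)

^≤treeSize-suc : ∀ d → c ^ d ≤ treeSize c (suc d)
^≤treeSize-suc     zero    = s≤s z≤n
^≤treeSize-suc {c} (suc d) = m≤n⇒m≤1+n (*-monoʳ-≤ c (^≤treeSize-suc d))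

treeSize<^ : 2 ≤ c → ∀ l → treeSize c l < c ^ l
treeSize<^ 2≤c zero        = s≤s z≤n
treeSize<^ {c} 2≤c (suc d) = <-≤-trans (treeSize-suc<2*^ 2≤c d) (*-monoˡ-≤ (c ^ d) 2≤c)

n<^n : 2 ≤ c → ∀ n → n < c ^ n
n<^n     2≤c zero    = s≤s z≤n
n<^n {c} 2≤c (suc n) = begin-strict
  suc n         <⟨ +-mono-≤ (≤-trans (s≤s z≤n) c^n>n) c^n>n ⟩
  c ^ n + c ^ n ≡⟨ cong (c ^ n +_) (+-identityʳ (c ^ n)) ⟨
  2 * c ^ n     ≤⟨ *-monoˡ-≤ (c ^ n) 2≤c ⟩
  c * c ^ n     ∎
  where
  open ≤-Reasoning
  c^n>n = n<^n 2≤c n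

floorLog-below : ∀ {k} m → 1 ≤ k → k < c ^ m → ∃[ D ] (c ^ D ≤ k × k < c ^ suc D)
floorLog-below         zero    (s≤s z≤n) (s≤s ())
floorLog-below {c} {k} (suc m) 1≤k k<c^1+m with k <? c ^ m
... | yes k<c^m = floorLog-below m 1≤k k<c^m
... | no  k≮c^m = m , ≮⇒≥ k≮c^m , k<c^1+m

floorLog : 2 ≤ c → ∀ {k} → 1 ≤ k → ∃[ D ] (c ^ D ≤ k × k < c ^ suc D)
floorLog 2≤c {k} 1≤k = floorLog-below k 1≤k (n<^n 2≤c k)

^-distribʳ-* : ∀ a b n → (a * b) ^ n ≡ a ^ n * b ^ n
^-distribʳ-* a b zero    = refl
^-distribʳ-* a b (suc n) = begin
  a * b * (a * b) ^ n     ≡⟨ cong (a * b *_) (^-distribʳ-* a b n) ⟩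
  a * b * (a ^ n * b ^ n) ≡⟨ *-comm-middle a b (a ^ n) (b ^ n) ⟩
  a * a ^ n * (b * b ^ n) ∎
  where
  open ≡-Reasoning
  *-comm-middle : ∀ w x y z → w * x * (y * z) ≡ w * y * (x * z)
  *-comm-middle = solve-∀

Budget-intro : ∀ {c′ k n K} m → K ≤ m * k → 2 ^ m * k ^ c′ ≤ n ^ c′ → Budget c′ k n K
Budget-intro {c′} {k} {n} {K} m K≤mk 2^m*k^c′≤n^c′ = begin
  k ^ (c′ * k) * 2 ^ K         ≤⟨ *-monoʳ-≤ (k ^ (c′ * k)) (^-monoʳ-≤ 2 K≤mk) ⟩
  k ^ (c′ * k) * 2 ^ (m * k)   ≡⟨ cong₂ _*_ (^-*-assoc k c′ k) (^-*-assoc 2 m k) ⟨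
  (k ^ c′) ^ k * (2 ^ m) ^ k   ≡⟨ *-comm ((k ^ c′) ^ k) ((2 ^ m) ^ k) ⟩
  (2 ^ m) ^ k * (k ^ c′) ^ k   ≡⟨ ^-distribʳ-* (2 ^ m) (k ^ c′) k ⟨
  (2 ^ m * k ^ c′) ^ k         ≤⟨ ^-monoˡ-≤ k 2^m*k^c′≤n^c′ ⟩
  (n ^ c′) ^ k                 ≡⟨ ^-*-assoc n c′ k ⟩
  n ^ (c′ * k)                 ∎
  where open ≤-Reasoning

^-reflectsʳ-< : 2 ≤ c → ∀ {a b} → c ^ a < c ^ b → a < b
^-reflectsʳ-< {c} 2≤c {a} {b} c^a<c^b with a <? b
... | yes a<b = a<b
... | no  a≮b = contradiction (^-monoʳ-≤ c {{>-nonZero (≤-trans (s≤s z≤n) 2≤c)}} (≮⇒≥ a≮b)) (<⇒≱ c^a<c^b)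

2^j*k≤2*n : 2 ≤ c → ∀ {k n} j → k ≤ n → k * c ^ j ≤ c * n → 2 ^ j * k ≤ 2 * n
2^j*k≤2*n     2≤c         zero     k≤n _            = *-mono-≤ (m≤m+n 1 1) k≤n
2^j*k≤2*n {c} 2≤c {k} {n} (suc j) _   k*c^1+j≤c*n = begin
  2 * 2 ^ j * k   ≡⟨ *-assoc 2 (2 ^ j) k ⟩
  2 * (2 ^ j * k) ≤⟨ *-monoʳ-≤ 2 (*-monoˡ-≤ k (^-monoˡ-≤ j 2≤c)) ⟩
  2 * (c ^ j * k) ≤⟨ *-monoʳ-≤ 2 (*-cancelˡ-≤ c {{>-nonZero (≤-trans (s≤s z≤n) 2≤c)}} c*c^j*k≤c*n) ⟩
  2 * n           ∎
  where
  open ≤-Reasoning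
  c*c^j*k≤c*n : c * (c ^ j * k) ≤ c * n
  c*c^j*k≤c*n = ≤-trans (≤-reflexive (trans (sym (*-assoc c (c ^ j) k)) (*-comm (c * c ^ j) k))) k*c^1+j≤c*n

2^[2+j]*k^4≤n^4 : ∀ {k n} j → 2 * k ≤ n → 2 ^ j * k ≤ 2 * n → 2 ^ (2 + j) * k ^ 4 ≤ n ^ 4
2^[2+j]*k^4≤n^4 {k} {n} j 2k≤n 2^j*k≤2n = begin
  2 ^ (2 + j) * k ^ 4     ≡⟨ regroupˡ (2 ^ j) k (k ^ 3) ⟩
  2 ^ j * k * (4 * k ^ 3) ≤⟨ *-monoˡ-≤ (4 * k ^ 3) 2^j*k≤2n ⟩
  2 * n * (4 * k ^ 3)     ≡⟨ regroupʳ n (k ^ 3) ⟩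
  n * (2 ^ 3 * k ^ 3)     ≡⟨ cong (n *_) (^-distribʳ-* 2 k 3) ⟨
  n * (2 * k) ^ 3         ≤⟨ *-monoʳ-≤ n (^-monoˡ-≤ 3 2k≤n) ⟩
  n * n ^ 3               ∎
  where
  open ≤-Reasoning
  regroupˡ : ∀ a b b³ → 2 * (2 * a) * (b * b³) ≡ a * b * (4 * b³)
  regroupˡ = solve-∀
  regroupʳ : ∀ a b³ → 2 * a * (4 * b³) ≡ a * (8 * b³)
  regroupʳ = solve-∀

rootedCover : 2 ≤ c → ∀ l {k} → 1 ≤ k → 2 * k < treeSize c l →
  (S : List (Word c)) → length S ≤ k → (∀ {w} → w ∈ S → IsNode l w) →
  ∃[ T ] (Budget 4 k (treeSize c l) (length T) × (∀ {w} → w ∈ T → IsNode l w)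
          × root ∈ T × Connected T × S ⊆ T)
rootedCover 2≤c zero 1≤k () S |S|≤k S-nodes
rootedCover {c} 2≤c (suc m) {k} 1≤k 2k<n S |S|≤k S-nodes with floorLog 2≤c 1≤k
... | D , c^D≤k , k<c^1+D =
  hull D S , budget , hull-nodes D D<1+m S-nodes , ∈-hull-ball D {S = S} z≤n ,
  parentClosed⇒connected (hull-parentClosed D {S = S}) , S⊆hull D
  where
  n = treeSize c (suc m)
  j = m ∸ D

  D<1+m : D < suc m
  D<1+m = ^-reflectsʳ-< 2≤c (begin-strict
    c ^ D       ≤⟨ c^D≤k ⟩
    k           ≤⟨ m≤m+n k (k + 0) ⟩
    2 * k       <⟨ 2k<n ⟩
    n           <⟨ treeSize<^ 2≤c (suc m) ⟩
    c ^ suc m   ∎)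
    where open ≤-Reasoning

  length-hull≤[2+j]*k : length (hull D S) ≤ (2 + j) * k
  length-hull≤[2+j]*k = begin
    length (hull D S)                    ≤⟨ length-hull≤ D (λ w∈S → ≤-pred (S-nodes w∈S)) ⟩
    length (ball {c} D) + length S * j   ≤⟨ +-mono-≤ length-ball≤2k (*-monoˡ-≤ j |S|≤k) ⟩
    2 * k + k * j                        ≡⟨ regroup k j ⟩
    (2 + j) * k                          ∎
    where
    open ≤-Reasoning
    length-ball≤2k : length (ball {c} D) ≤ 2 * k
    length-ball≤2k = ≤-trans (length-ball≤treeSize D)
      (≤-trans (<⇒≤ (treeSize-suc<2*^ 2≤c D)) (*-monoʳ-≤ 2 c^D≤k))
    regroup : ∀ a b → 2 * a + a * b ≡ (2 + b) * a
    regroup = solve-∀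

  k*c^j≤c*n : k * c ^ j ≤ c * n
  k*c^j≤c*n = begin
    k * c ^ j             ≤⟨ *-monoˡ-≤ (c ^ j) (<⇒≤ k<c^1+D) ⟩
    c ^ suc D * c ^ j     ≡⟨ ^-distribˡ-+-* c (suc D) j ⟨
    c ^ suc (D + j)       ≡⟨ cong (λ e → c ^ suc e) (m+[n∸m]≡n (≤-pred D<1+m)) ⟩
    c * c ^ m             ≤⟨ *-monoʳ-≤ c (^≤treeSize-suc m) ⟩
    c * n                 ∎
    where open ≤-Reasoning

  budget : Budget 4 k n (length (hull D S))
  budget = Budget-intro {4} {k} {n} (2 + j) length-hull≤[2+j]*k
    (2^[2+j]*k^4≤n^4 j (<⇒≤ 2k<n)
      (2^j*k≤2*n 2≤c j (≤-trans (m≤m+n k (k + 0)) (<⇒≤ 2k<n)) k*c^j≤c*n))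

claimB4 : (c : ℕ) → 2 ≤ c →
    ∃[ c' ] ((l k : ℕ) → 1 ≤ k → 2 * k < treeSize c l →
    (A : Set) (0# : A) (x : TNode c l → A) →
    Sparse A 0# k x →
    ∃[ K ] (Budget c' k (treeSize c l) K × InTK A 0# K x))
claimB4 c 2≤c = 4 , λ l k 1≤k 2k<n A 0# x (S , |S|≤k , S-nodes , supp) →
  let T , budget , T-nodes , root∈T , T-connected , S⊆T = rootedCover 2≤c l 1≤k 2k<n S |S|≤k S-nodes
  in  length T , budget , T , ≤-refl , T-nodes , root∈T , T-connected , λ p xp≢0# → S⊆T (supp p xp≢0#)
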